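{- Let $k\geq 2$. There is no $k$-geodetic digraph with minimum out-degree at least $2$ and order $M(2,k)+2$ (where $M(2,k)=1+2+\dots+2^k$) whose in-degree sequence is $(1,1,1,1,2,\dots,2,4,4)$, i.e. exactly four vertices have in-degree $1$, exactly two have in-degree $4$, and all others have in-degree $2$.
   Context: A digraph is $k$-geodetic if for any two vertices $u,v$ there is at most one directed walk from $u$ to $v$ of length at most $k$. The in-degree sequence is the list of in-degrees of the vertices in non-decreasing order. -}

module Defs where

open import Data.Nat using (ℕ; zero; suc; _+_; _*_; _^_; _≤_)
open import Data.Bool using (Bool; true; false)
open import Data.Fin using (Fin)
open import Data.Product using (_×_)
open import Data.Sum using (_⊎_)
open import Relation.Binary.PropositionalEquality using (_≡_)
open import Relation.Nullary.Decidable using (⌊_⌋)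
open import Data.Nat using (_≟_)

Digraph : ℕ → Set
Digraph n = Fin n → Fin n → Bool

Σ-Fin : {n : ℕ} → (Fin n → ℕ) → ℕ
Σ-Fin {zero}  f = 0
Σ-Fin {suc n} f = f Fin.zero + Σ-Fin {n} (λ i → f (Fin.suc i))

b2n : Bool → ℕ
b2n true  = 1
b2n false = 0

count : {n : ℕ} → (Fin n → Bool) → ℕ
count p = Σ-Fin (λ i → b2n (p i))

outDeg : {n : ℕ} → Digraph n → Fin n → ℕ
outDeg G u = count (λ v → G u v)

inDeg : {n : ℕ} → Digraph n → Fin n → ℕ
inDeg G v = count (λ u → G u v)

walks : {n : ℕ} → Digraph n → ℕ → Fin n → Fin n → ℕ
walks G zero    u v = b2n ⌊ Data.Fin._≟_ u v ⌋
walks G (suc ℓ) u v = Σ-Fin (λ w → b2n (G u w) * walks G ℓ w v)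

walksUpTo : {n : ℕ} → Digraph n → ℕ → Fin n → Fin n → ℕ
walksUpTo G zero    u v = walks G zero u v
walksUpTo G (suc k) u v = walksUpTo G k u v + walks G (suc k) u v

IsGeodetic : {n : ℕ} → ℕ → Digraph n → Set
IsGeodetic {n} k G = (u v : Fin n) → walksUpTo G k u v ≤ 1

MinOutDeg≥ : {n : ℕ} → ℕ → Digraph n → Set
MinOutDeg≥ {n} d G = (u : Fin n) → d ≤ outDeg G u

Moore : ℕ → ℕ → ℕ
Moore d zero    = 1
Moore d (suc k) = Moore d k + d ^ suc k

InSeq-1111-2-44 : {n : ℕ} → Digraph n → Set
InSeq-1111-2-44 {n} G =
  (count (λ v → ⌊ inDeg G v ≟ 1 ⌋) ≡ 4) × ((count (λ v → ⌊ inDeg G v ≟ 4 ⌋) ≡ 2) ×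
  ((v : Fin n) → (inDeg G v ≡ 1) ⊎ ((inDeg G v ≡ 2) ⊎ (inDeg G v ≡ 4))))

module Submission where

-- Write A for the adjacency matrix,
-- F = I + A + … + A^k for the matrix of walks of length ≤ k (a 0/1 matrix by
-- geodecity) and R = J − F for the outlier matrix.
--
--  * The in-degrees sum to 2n, so G is out-regular of degree 2.
--  * Every row of F sums to at least M(2,k), so each vertex has ≤ 2 outliers.
--  * A commutes with F, hence (AF)(u,v) + (AR)(u,v) = d⁺(u) = 2 and
--    (AF)(u,v) + (RA)(u,v) = d⁻(v).  For d⁻(v) = 4 this forces (AR)(u,v) = 0
--    and every outlier of u to be an in-neighbour of v; for d⁻(a) = 1 it forces
--    a to be an outlier of one of its out-neighbours, so a → v for each v of
--    in-degree 4.  Counting, the two vertices v₁ ≠ v₂ of in-degree 4 have the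
--    same four in-neighbours.
--  * Then F(v₂,v₁) = 1 and any walk ending in v₁ can be redirected to v₂, so
--    F(v₂,v₂) ≥ 2, contradicting geodecity.
--
-- The argument does not use the hypothesis k ≥ 2.

open import Defs
open import Data.Nat using (ℕ; _≤_; _+_)
open import Relation.Nullary using (¬_)
open import Data.Product using (_×_)

open import Data.Nat using (zero; suc; _*_; _∸_; _^_; _<_; z≤n; s≤s)
import Data.Nat as ℕ
open import Data.Nat.Properties
open import Data.Fin using (Fin; zero; suc)
import Data.Fin.Properties as Fin
open import Data.Bool using (Bool; true; false; T)
open import Data.Product using (∃; ∃₂; _,_; proj₁; proj₂)
open import Data.Empty using (⊥; ⊥-elim)
open import Data.Unit using (tt)
open import Data.Sum using (inj₁; inj₂)
open import Function using (_∘_)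
open import Relation.Nullary using (Dec; yes; no)
open import Relation.Nullary.Decidable using (⌊_⌋; toWitness)
open import Relation.Binary.PropositionalEquality
open import Algebra.Properties.Semiring.Sum +-*-semiring
  using (sum; sum-cong-≗; ∑-distrib-+; ∑-comm; *-distribˡ-sum; *-distribʳ-sum)
open import Algebra.Properties.CommutativeSemigroup +-commutativeSemigroup
  using (xy∙z≈xz∙y)

Σ≡sum : ∀ {n} (f : Fin n → ℕ) → Σ-Fin f ≡ sum f
Σ≡sum {zero}  f = refl
Σ≡sum {suc n} f = cong (f zero +_) (Σ≡sum (f ∘ suc))

Σ-cong : ∀ {n} {f g : Fin n → ℕ} → (∀ i → f i ≡ g i) → Σ-Fin f ≡ Σ-Fin g
Σ-cong {f = f} {g} f≗g = trans (Σ≡sum f) (trans (sum-cong-≗ f≗g) (sym (Σ≡sum g)))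

Σ-+ : ∀ {n} (f g : Fin n → ℕ) → Σ-Fin (λ i → f i + g i) ≡ Σ-Fin f + Σ-Fin g
Σ-+ f g = trans (Σ≡sum (λ i → f i + g i))
           (trans (∑-distrib-+ f g) (sym (cong₂ _+_ (Σ≡sum f) (Σ≡sum g))))

Σ-*ˡ : ∀ {n} (c : ℕ) (f : Fin n → ℕ) → Σ-Fin (λ i → c * f i) ≡ c * Σ-Fin f
Σ-*ˡ c f = trans (Σ≡sum (λ i → c * f i))
            (trans (sym (*-distribˡ-sum c f)) (cong (c *_) (sym (Σ≡sum f))))

Σ-*ʳ : ∀ {n} (c : ℕ) (f : Fin n → ℕ) → Σ-Fin (λ i → f i * c) ≡ Σ-Fin f * c
Σ-*ʳ c f = trans (Σ≡sum (λ i → f i * c))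
            (trans (sym (*-distribʳ-sum c f)) (cong (_* c) (sym (Σ≡sum f))))

Σ-swap : ∀ {m n} (h : Fin m → Fin n → ℕ) →
         Σ-Fin (λ i → Σ-Fin (λ j → h i j)) ≡ Σ-Fin (λ j → Σ-Fin (λ i → h i j))
Σ-swap h = begin
  Σ-Fin (λ i → Σ-Fin (h i))            ≡⟨ Σ-cong (λ i → Σ≡sum (h i)) ⟩
  Σ-Fin (λ i → sum (h i))              ≡⟨ Σ≡sum (λ i → sum (h i)) ⟩
  sum (λ i → sum (h i))                ≡⟨ ∑-comm h ⟩
  sum (λ j → sum (λ i → h i j))        ≡⟨ Σ≡sum (λ j → sum (λ i → h i j)) ⟨
  Σ-Fin (λ j → sum (λ i → h i j))      ≡⟨ Σ-cong (λ j → Σ≡sum (λ i → h i j)) ⟨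
  Σ-Fin (λ j → Σ-Fin (λ i → h i j))    ∎
  where open ≡-Reasoning

Σ-const : ∀ {n} (c : ℕ) → Σ-Fin {n} (λ _ → c) ≡ n * c
Σ-const {zero}  c = refl
Σ-const {suc n} c = cong (c +_) (Σ-const {n} c)

Σ-mono : ∀ {n} {f g : Fin n → ℕ} → (∀ i → f i ≤ g i) → Σ-Fin f ≤ Σ-Fin g
Σ-mono {zero}  f≤g = z≤n
Σ-mono {suc n} f≤g = +-mono-≤ (f≤g zero) (Σ-mono (f≤g ∘ suc))

term≤Σ : ∀ {n} (f : Fin n → ℕ) (i : Fin n) → f i ≤ Σ-Fin f
term≤Σ f zero    = m≤m+n (f zero) _
term≤Σ f (suc i) = ≤-trans (term≤Σ (f ∘ suc) i) (m≤n+m _ (f zero))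

Σ-pos : ∀ {n} (f : Fin n → ℕ) → 1 ≤ Σ-Fin f → ∃ λ i → 1 ≤ f i
Σ-pos {suc n} f pos with f zero in eq
... | suc _ = zero , subst (1 ≤_) (sym eq) (s≤s z≤n)
... | zero  with Σ-pos (f ∘ suc) pos
...   | i , fi-pos = suc i , fi-pos

Σ-tight : ∀ {n} {f g : Fin n → ℕ} → (∀ i → f i ≤ g i) → Σ-Fin g ≤ Σ-Fin f →
          ∀ i → g i ≤ f i
Σ-tight {suc n} {f} {g} f≤g Σg≤Σf = go
  where
  rest≤ : Σ-Fin (f ∘ suc) ≤ Σ-Fin (g ∘ suc)
  rest≤ = Σ-mono (f≤g ∘ suc)
  go : ∀ i → g i ≤ f i
  go zero    = +-cancelʳ-≤ _ (g zero) (f zero) (≤-trans Σg≤Σf (+-monoʳ-≤ (f zero) rest≤))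
  go (suc i) = Σ-tight (f≤g ∘ suc)
    (+-cancelˡ-≤ (g zero) _ _ (≤-trans Σg≤Σf (+-monoˡ-≤ _ (f≤g zero)))) i

b2n≤1 : ∀ b → b2n b ≤ 1
b2n≤1 true  = s≤s z≤n
b2n≤1 false = z≤n

b2n-≤ : ∀ b {m} → (1 ≤ b2n b → 1 ≤ m) → b2n b ≤ m
b2n-≤ true  pos = pos (s≤s z≤n)
b2n-≤ false _   = z≤n

b2n-pos : ∀ {b} → 1 ≤ b2n b → T b
b2n-pos {true} _ = tt

indicator-pos : ∀ {P : Set} (P? : Dec P) → 1 ≤ b2n ⌊ P? ⌋ → P
indicator-pos P? pos = toWitness (b2n-pos pos)

count-witness : ∀ {n} (p : Fin n → Bool) → 1 ≤ count p → ∃ λ v → T (p v)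
count-witness p pos with Σ-pos (b2n ∘ p) pos
... | v , pv = v , b2n-pos pv

count-two-witnesses : ∀ {n} (p : Fin n → Bool) → 2 ≤ count p →
                      ∃₂ λ v w → v ≢ w × T (p v) × T (p w)
count-two-witnesses {suc n} p two with p zero in eq
... | true  with count-witness (p ∘ suc) (+-cancelˡ-≤ 1 1 _ two)
...   | w , pw = zero , suc w , (λ ()) , subst T (sym eq) tt , pw
count-two-witnesses {suc n} p two | false
  with count-two-witnesses (p ∘ suc) two
... | v , w , v≢w , pv , pw = suc v , suc w , v≢w ∘ Fin.suc-injective , pv , pw

pos-factorʳ : ∀ a b → 1 ≤ a * b → 1 ≤ b
pos-factorʳ a zero    pos = ⊥-elim (<-irrefl (sym (*-zeroʳ a)) pos)
pos-factorʳ a (suc b) _   = s≤s z≤n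

≤-pos-factor : ∀ a b → 1 ≤ a → b ≤ a * b
≤-pos-factor (suc a) b _ = m≤n*m b (suc a)

*-b2n≤ : ∀ a b → a * b2n b ≤ a
*-b2n≤ a b = ≤-trans (*-monoʳ-≤ a (b2n≤1 b)) (≤-reflexive (*-identityʳ a))

δ : ∀ {n} → Fin n → Fin n → ℕ
δ u v = b2n ⌊ u Fin.≟ v ⌋

δ-refl : ∀ {n} (u : Fin n) → δ u u ≡ 1
δ-refl u with u Fin.≟ u
... | yes _   = refl
... | no  u≢u = ⊥-elim (u≢u refl)

δ-≢ : ∀ {n} {u v : Fin n} → u ≢ v → δ u v ≡ 0
δ-≢ {u = u} {v} u≢v with u Fin.≟ v
... | yes u≡v = ⊥-elim (u≢v u≡v)
... | no  _   = refl

δ-sym : ∀ {n} (u v : Fin n) → δ u v ≡ δ v u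
δ-sym u v with u Fin.≟ v | v Fin.≟ u
... | yes _   | yes _   = refl
... | no  _   | no  _   = refl
... | yes u≡v | no  v≢u = ⊥-elim (v≢u (sym u≡v))
... | no  u≢v | yes v≡u = ⊥-elim (u≢v (sym v≡u))

δ-suc : ∀ {n} (u v : Fin n) → δ (suc u) (suc v) ≡ δ u v
δ-suc u v with suc u Fin.≟ suc v | u Fin.≟ v
... | yes _   | yes _   = refl
... | no  _   | no  _   = refl
... | yes su≡sv | no u≢v = ⊥-elim (u≢v (Fin.suc-injective su≡sv))
... | no su≢sv | yes u≡v = ⊥-elim (su≢sv (cong suc u≡v))

Σ-zeros : ∀ {n} → Σ-Fin {n} (λ _ → 0) ≡ 0
Σ-zeros {n} = trans (Σ-const {n} 0) (*-zeroʳ n)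

Σ-δˡ : ∀ {n} (u : Fin n) (h : Fin n → ℕ) → Σ-Fin (λ w → δ u w * h w) ≡ h u
Σ-δˡ {suc n} zero h = trans (cong₂ _+_ (+-identityʳ (h zero)) (Σ-zeros {n})) (+-identityʳ (h zero))
Σ-δˡ (suc u) h = trans (Σ-cong (λ w → cong (_* h (suc w)) (δ-suc u w))) (Σ-δˡ u (h ∘ suc))

Σ-δʳ : ∀ {n} (v : Fin n) (h : Fin n → ℕ) → Σ-Fin (λ w → h w * δ w v) ≡ h v
Σ-δʳ v h = trans (Σ-cong (λ w → trans (*-comm (h w) (δ w v)) (cong (_* h w) (δ-sym w v))))
                 (Σ-δˡ v h)

-- Walk counting in an arbitrary digraph.  A is the 0/1 adjacency matrix, so
-- walks G ℓ = A^ℓ and walksUpTo G k = I + A + … + A^k.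

module Walks {n : ℕ} (G : Digraph n) where

  A : Fin n → Fin n → ℕ
  A u v = b2n (G u v)

  walks-snoc : ∀ ℓ u v → walks G (suc ℓ) u v ≡ Σ-Fin (λ w → walks G ℓ u w * A w v)
  walks-snoc zero    u v = trans (Σ-δʳ v (A u)) (sym (Σ-δˡ u (λ w → A w v)))
  walks-snoc (suc ℓ) u v = begin
    Σ-Fin (λ w → A u w * walks G (suc ℓ) w v)
      ≡⟨ Σ-cong (λ w → cong (A u w *_) (walks-snoc ℓ w v)) ⟩
    Σ-Fin (λ w → A u w * Σ-Fin (λ x → walks G ℓ w x * A x v))
      ≡⟨ Σ-cong (λ w → sym (Σ-*ˡ (A u w) (λ x → walks G ℓ w x * A x v))) ⟩
    Σ-Fin (λ w → Σ-Fin (λ x → A u w * (walks G ℓ w x * A x v)))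
      ≡⟨ Σ-cong (λ w → Σ-cong (λ x → sym (*-assoc (A u w) (walks G ℓ w x) (A x v)))) ⟩
    Σ-Fin (λ w → Σ-Fin (λ x → (A u w * walks G ℓ w x) * A x v))
      ≡⟨ Σ-swap (λ w x → (A u w * walks G ℓ w x) * A x v) ⟩
    Σ-Fin (λ x → Σ-Fin (λ w → (A u w * walks G ℓ w x) * A x v))
      ≡⟨ Σ-cong (λ x → Σ-*ʳ (A x v) (λ w → A u w * walks G ℓ w x)) ⟩
    Σ-Fin (λ x → walks G (suc ℓ) u x * A x v) ∎
    where open ≡-Reasoning

  walksUpTo-comm : ∀ k u v → Σ-Fin (λ w → A u w * walksUpTo G k w v)
                           ≡ Σ-Fin (λ w → walksUpTo G k u w * A w v)
  walksUpTo-comm zero    u v = walks-snoc zero u v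
  walksUpTo-comm (suc k) u v = begin
    Σ-Fin (λ w → A u w * (walksUpTo G k w v + walks G (suc k) w v))
      ≡⟨ Σ-cong (λ w → *-distribˡ-+ (A u w) (walksUpTo G k w v) (walks G (suc k) w v)) ⟩
    Σ-Fin (λ w → A u w * walksUpTo G k w v + A u w * walks G (suc k) w v)
      ≡⟨ Σ-+ (λ w → A u w * walksUpTo G k w v) (λ w → A u w * walks G (suc k) w v) ⟩
    Σ-Fin (λ w → A u w * walksUpTo G k w v) + walks G (suc (suc k)) u v
      ≡⟨ cong₂ _+_ (walksUpTo-comm k u v) (walks-snoc (suc k) u v) ⟩
    Σ-Fin (λ w → walksUpTo G k u w * A w v) + Σ-Fin (λ w → walks G (suc k) u w * A w v)
      ≡⟨ Σ-+ (λ w → walksUpTo G k u w * A w v) (λ w → walks G (suc k) u w * A w v) ⟨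
    Σ-Fin (λ w → walksUpTo G k u w * A w v + walks G (suc k) u w * A w v)
      ≡⟨ Σ-cong (λ w → *-distribʳ-+ (A w v) (walksUpTo G k u w) (walks G (suc k) u w)) ⟨
    Σ-Fin (λ w → (walksUpTo G k u w + walks G (suc k) u w) * A w v) ∎
    where open ≡-Reasoning

  walks-lower : ∀ {d} → MinOutDeg≥ d G → ∀ ℓ u → d ^ ℓ ≤ Σ-Fin (walks G ℓ u)
  walks-lower _ zero u =
    ≤-reflexive (sym (trans (Σ-cong (λ w → sym (*-identityʳ (δ u w)))) (Σ-δˡ u (λ _ → 1))))
  walks-lower {d} minOut (suc ℓ) u = begin
    d * d ^ ℓ                                  ≤⟨ *-monoˡ-≤ (d ^ ℓ) (minOut u) ⟩
    outDeg G u * d ^ ℓ                         ≡⟨ Σ-*ʳ (d ^ ℓ) (A u) ⟨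
    Σ-Fin (λ x → A u x * d ^ ℓ)                ≤⟨ Σ-mono (λ x → *-monoʳ-≤ (A u x) (walks-lower minOut ℓ x)) ⟩
    Σ-Fin (λ x → A u x * Σ-Fin (walks G ℓ x))  ≡⟨ Σ-cong (λ x → Σ-*ˡ (A u x) (walks G ℓ x)) ⟨
    Σ-Fin (λ x → Σ-Fin (λ w → A u x * walks G ℓ x w)) ≡⟨ Σ-swap (λ x w → A u x * walks G ℓ x w) ⟩
    Σ-Fin (walks G (suc ℓ) u)                  ∎
    where open ≤-Reasoning

  moore-lower : ∀ {d} → MinOutDeg≥ d G → ∀ k u → Moore d k ≤ Σ-Fin (walksUpTo G k u)
  moore-lower minOut zero    u = walks-lower minOut zero u
  moore-lower minOut (suc k) u =
    ≤-trans (+-mono-≤ (moore-lower minOut k u) (walks-lower minOut (suc k) u))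
            (≤-reflexive (sym (Σ-+ (walksUpTo G k u) (walks G (suc k) u))))

  -- If every in-neighbour of a is an in-neighbour of b, each walk of length
  -- ≤ j from u to a, except the trivial one, is redirected to a walk to b.
  redirect : ∀ {a b} → (∀ w → A w a ≤ A w b) → ∀ j u →
             walksUpTo G j u a + δ u b ≤ walksUpTo G j u b + δ u a
  redirect _ zero u = ≤-reflexive (+-comm (δ u _) (δ u _))
  redirect {a} {b} a⊆b (suc j) u = begin
    (Fa + Wa) + δ u b  ≡⟨ xy∙z≈xz∙y Fa Wa (δ u b) ⟩
    (Fa + δ u b) + Wa  ≤⟨ +-mono-≤ (redirect a⊆b j u) Wa≤Wb ⟩
    (Fb + δ u a) + Wb  ≡⟨ xy∙z≈xz∙y Fb (δ u a) Wb ⟩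
    (Fb + Wb) + δ u a  ∎
    where
    open ≤-Reasoning
    Fa = walksUpTo G j u a
    Fb = walksUpTo G j u b
    Wa = walks G (suc j) u a
    Wb = walks G (suc j) u b
    Wa≤Wb : Wa ≤ Wb
    Wa≤Wb = begin
      Wa                                       ≡⟨ walks-snoc j u a ⟩
      Σ-Fin (λ w → walks G j u w * A w a)      ≤⟨ Σ-mono (λ w → *-monoʳ-≤ (walks G j u w) (a⊆b w)) ⟩
      Σ-Fin (λ w → walks G j u w * A w b)      ≡⟨ walks-snoc j u b ⟨
      Wb                                       ∎

  -- Degree sums agree, so a lower bound d on out-degrees together with the
  -- in-degree sum n·d forces every out-degree to equal d.
  out-regular : ∀ {d} → MinOutDeg≥ d G → Σ-Fin (inDeg G) ≡ n * d → ∀ u → outDeg G u ≡ d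
  out-regular {d} minOut inSum u = ≤-antisym out≤d (minOut u)
    where
    out≤d : outDeg G u ≤ d
    out≤d = Σ-tight {f = λ _ → d} {g = outDeg G} minOut
              (≤-reflexive (trans (Σ-swap A) (trans inSum (sym (Σ-const {n} d))))) u

-- Two pieces of arithmetic behind the outlier analysis, with x = (AF)(u,v),
-- a = (AR)(u,v), r = (RA)(u,v), out-degree d and in-degree d + ε or i < d.

excess-arith : ∀ {x a r d ε} → x + a ≡ d → x + r ≡ d + ε → r ≤ ε → a ≡ 0 × ε ≤ r
excess-arith {x} {a} {r} {d} {ε} xa xr r≤ε = a≡0 , subst (ε ≤_) (sym r≡a+ε) (m≤n+m ε a)
  where
  r≡a+ε : r ≡ a + ε
  r≡a+ε = +-cancelˡ-≡ x r (a + ε) (trans xr (trans (cong (_+ ε) (sym xa)) (+-assoc x a ε)))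
  a≡0 : a ≡ 0
  a≡0 = n≤0⇒n≡0 (+-cancelʳ-≤ ε a 0 (subst (_≤ ε) r≡a+ε r≤ε))

deficit-arith : ∀ {x a r i d} → x + a ≡ d → x + r ≡ i → i < d → 1 ≤ a
deficit-arith {x} {zero} {r} xa xr i<d =
  ⊥-elim (<⇒≱ i<d (≤-trans (≤-reflexive (sym (trans (sym (+-identityʳ x)) xa)))
                           (≤-trans (m≤m+n x r) (≤-reflexive xr))))
deficit-arith {a = suc _} _ _ _ = s≤s z≤n

-- F(u,v) ∈ {0,1} says whether v is reached from u by a walk of
-- length ≤ k; otherwise v is an outlier of u, recorded by R(u,v) = 1.

module Outliers {k d ε : ℕ} (G : Digraph (Moore d k + ε))
                (geodetic : IsGeodetic k G) (regular : ∀ u → outDeg G u ≡ d) where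

  open Walks G

  F : Fin (Moore d k + ε) → Fin (Moore d k + ε) → ℕ
  F = walksUpTo G k

  R : Fin (Moore d k + ε) → Fin (Moore d k + ε) → ℕ
  R u v = 1 ∸ F u v

  F+R≡1 : ∀ u v → F u v + R u v ≡ 1
  F+R≡1 u v = m+[n∸m]≡n (geodetic u v)

  -- Each vertex has at most ε outliers, since its row of F sums to ≥ M(d,k).
  outliers≤ε : ∀ u → Σ-Fin (R u) ≤ ε
  outliers≤ε u = +-cancelˡ-≤ (Moore d k) _ ε (begin
    Moore d k + Σ-Fin (R u)     ≤⟨ +-monoˡ-≤ (Σ-Fin (R u)) (moore-lower minOut k u) ⟩
    Σ-Fin (F u) + Σ-Fin (R u)   ≡⟨ Σ-+ (F u) (R u) ⟨
    Σ-Fin (λ v → F u v + R u v) ≡⟨ Σ-cong (F+R≡1 u) ⟩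
    Σ-Fin {Moore d k + ε} (λ _ → 1) ≡⟨ trans (Σ-const {Moore d k + ε} 1) (*-identityʳ _) ⟩
    Moore d k + ε               ∎)
    where
    open ≤-Reasoning
    minOut : MinOutDeg≥ d G
    minOut u = ≤-reflexive (sym (regular u))

  AF AR RA : Fin (Moore d k + ε) → Fin (Moore d k + ε) → ℕ
  AF u v = Σ-Fin (λ w → A u w * F w v)
  AR u v = Σ-Fin (λ w → A u w * R w v)
  RA u v = Σ-Fin (λ w → R u w * A w v)

  -- A(F + R) = AJ: row sums of A are the out-degrees.
  AF+AR : ∀ u v → AF u v + AR u v ≡ d
  AF+AR u v = begin
    AF u v + AR u v                           ≡⟨ Σ-+ (λ w → A u w * F w v) (λ w → A u w * R w v) ⟨
    Σ-Fin (λ w → A u w * F w v + A u w * R w v) ≡⟨ Σ-cong (λ w → *-distribˡ-+ (A u w) (F w v) (R w v)) ⟨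
    Σ-Fin (λ w → A u w * (F w v + R w v))     ≡⟨ Σ-cong (λ w → cong (A u w *_) (F+R≡1 w v)) ⟩
    Σ-Fin (λ w → A u w * 1)                   ≡⟨ Σ-cong (λ w → *-identityʳ (A u w)) ⟩
    outDeg G u                                ≡⟨ regular u ⟩
    d                                         ∎
    where open ≡-Reasoning

  -- AF = FA and (F + R)A = JA: column sums of A are the in-degrees.
  AF+RA : ∀ u v → AF u v + RA u v ≡ inDeg G v
  AF+RA u v = begin
    AF u v + RA u v                             ≡⟨ cong (_+ RA u v) (walksUpTo-comm k u v) ⟩
    Σ-Fin (λ w → F u w * A w v) + RA u v        ≡⟨ Σ-+ (λ w → F u w * A w v) (λ w → R u w * A w v) ⟨
    Σ-Fin (λ w → F u w * A w v + R u w * A w v) ≡⟨ Σ-cong (λ w → *-distribʳ-+ (A w v) (F u w) (R u w)) ⟨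
    Σ-Fin (λ w → (F u w + R u w) * A w v)       ≡⟨ Σ-cong (λ w → cong (_* A w v) (F+R≡1 u w)) ⟩
    Σ-Fin (λ w → 1 * A w v)                     ≡⟨ Σ-cong (λ w → *-identityˡ (A w v)) ⟩
    inDeg G v                                   ∎
    where open ≡-Reasoning

  max-in-degree : ∀ {v} → inDeg G v ≡ d + ε → ∀ u →
                  AR u v ≡ 0 × (∀ w → 1 ≤ R u w → 1 ≤ A w v)
  max-in-degree {v} in≡d+ε u = AR≡0 , outlier⇒arc
    where
    RA≤ΣR : RA u v ≤ Σ-Fin (R u)
    RA≤ΣR = Σ-mono (λ w → *-b2n≤ (R u w) (G w v))
    split = excess-arith (AF+AR u v) (trans (AF+RA u v) in≡d+ε) (≤-trans RA≤ΣR (outliers≤ε u))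
    AR≡0 = proj₁ split
    R≤RA : ∀ w → R u w ≤ R u w * A w v
    R≤RA = Σ-tight (λ w → *-b2n≤ (R u w) (G w v)) (≤-trans (outliers≤ε u) (proj₂ split))
    outlier⇒arc : ∀ w → 1 ≤ R u w → 1 ≤ A w v
    outlier⇒arc w Ruw = pos-factorʳ (R u w) (A w v) (≤-trans Ruw (R≤RA w))

  -- A vertex of in-degree < d is an outlier of one of its out-neighbours,
  -- hence an in-neighbour of every vertex of in-degree d + ε.
  low-in-degree-feeds-max : ∀ {a v} → inDeg G a < d → inDeg G v ≡ d + ε → 1 ≤ A a v
  low-in-degree-feeds-max {a} {v} in<d in≡d+ε =
    proj₂ (max-in-degree in≡d+ε w) a (pos-factorʳ (A a w) (R w a) Rwa)
    where
    witness = Σ-pos (λ w → A a w * R w a) (deficit-arith (AF+AR a a) (AF+RA a a) in<d)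
    w = proj₁ witness
    Rwa = proj₂ witness

  -- Two distinct vertices v₁, v₂, where v₁ has in-degree d + ε and all its
  -- in-neighbours are in-neighbours of v₂, cannot exist: v₁ is reached from
  -- v₂, and redirecting that walk gives a second closed walk at v₂.
  no-dominated-max-vertex : ∀ {v₁ v₂} → v₁ ≢ v₂ → 1 ≤ d + ε → inDeg G v₁ ≡ d + ε →
                            (∀ w → A w v₁ ≤ A w v₂) → ⊥
  no-dominated-max-vertex {v₁} {v₂} v₁≢v₂ pos in≡d+ε v₁⊆v₂ =
    <⇒≱ (s≤s (s≤s z≤n)) (≤-trans two≤F (geodetic v₂ v₂))
    where
    inNeighbour = Σ-pos (λ u → A u v₁) (subst (1 ≤_) (sym in≡d+ε) pos)
    u = proj₁ inNeighbour
    u→v₂ : 1 ≤ A u v₂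
    u→v₂ = ≤-trans (proj₂ inNeighbour) (v₁⊆v₂ u)
    R≡0 : R v₂ v₁ ≡ 0
    R≡0 = n≤0⇒n≡0 (begin
      R v₂ v₁                 ≤⟨ ≤-pos-factor (A u v₂) (R v₂ v₁) u→v₂ ⟩
      A u v₂ * R v₂ v₁        ≤⟨ term≤Σ (λ w → A u w * R w v₁) v₂ ⟩
      AR u v₁                 ≡⟨ proj₁ (max-in-degree in≡d+ε u) ⟩
      0                       ∎)
      where open ≤-Reasoning
    reached : F v₂ v₁ ≡ 1
    reached = trans (sym (+-identityʳ _)) (trans (cong (F v₂ v₁ +_) (sym R≡0)) (F+R≡1 v₂ v₁))
    two≤F : 2 ≤ F v₂ v₂
    two≤F = begin
      2                       ≡⟨ cong₂ _+_ reached (δ-refl v₂) ⟨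
      F v₂ v₁ + δ v₂ v₂       ≤⟨ redirect v₁⊆v₂ k v₂ ⟩
      F v₂ v₂ + δ v₂ v₁       ≡⟨ trans (cong (F v₂ v₂ +_) (δ-≢ (v₁≢v₂ ∘ sym))) (+-identityʳ _) ⟩
      F v₂ v₂                 ∎
      where open ≤-Reasoning

-- The in-degree sequence (1,1,1,1,2,…,2,4,4) sums to 2n: adding one for each
-- vertex of in-degree 1 and subtracting two for each of in-degree 4 gives 2
-- at every vertex.
inSeq-degreeSum : ∀ {n} (G : Digraph n) → InSeq-1111-2-44 G → Σ-Fin (inDeg G) ≡ n * 2
inSeq-degreeSum {n} G (ones , fours , degrees) = +-cancelʳ-≡ 4 _ _ (begin
  Σ-Fin (inDeg G) + 4                             ≡⟨ cong (Σ-Fin (inDeg G) +_) ones ⟨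
  Σ-Fin (inDeg G) + Σ-Fin is1                     ≡⟨ Σ-+ (inDeg G) is1 ⟨
  Σ-Fin (λ v → inDeg G v + is1 v)                 ≡⟨ Σ-cong balance ⟩
  Σ-Fin (λ v → 2 + 2 * is4 v)                     ≡⟨ Σ-+ (λ _ → 2) (λ v → 2 * is4 v) ⟩
  Σ-Fin {n} (λ _ → 2) + Σ-Fin (λ v → 2 * is4 v)   ≡⟨ cong₂ _+_ (Σ-const {n} 2) (Σ-*ˡ 2 is4) ⟩
  n * 2 + 2 * Σ-Fin is4                           ≡⟨ cong (λ c → n * 2 + 2 * c) fours ⟩
  n * 2 + 4                                       ∎)
  where
  open ≡-Reasoning
  is1 is4 : Fin n → ℕ
  is1 v = b2n ⌊ inDeg G v ℕ.≟ 1 ⌋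
  is4 v = b2n ⌊ inDeg G v ℕ.≟ 4 ⌋
  balance : ∀ v → inDeg G v + is1 v ≡ 2 + 2 * is4 v
  balance v with degrees v
  ... | inj₁ in≡1        rewrite in≡1 = refl
  ... | inj₂ (inj₁ in≡2) rewrite in≡2 = refl
  ... | inj₂ (inj₂ in≡4) rewrite in≡4 = refl

module InDegreeSequence {k : ℕ} (G : Digraph (Moore 2 k + 2)) (geodetic : IsGeodetic k G)
                        (regular : ∀ u → outDeg G u ≡ 2)
                        (ones : count (λ v → ⌊ inDeg G v ℕ.≟ 1 ⌋) ≡ 4) where

  open Walks G using (A)
  open Outliers {k} {2} {2} G geodetic regular using (low-in-degree-feeds-max)

  in≡1⇒<2 : ∀ {x} → inDeg G x ≡ 1 → inDeg G x < 2
  in≡1⇒<2 in≡1 = ≤-reflexive (cong suc in≡1)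

  -- The in-neighbours of a vertex of in-degree 4 are exactly the four vertices
  -- of in-degree 1: each of those is an in-neighbour, and there are only four.
  inNeighbour-of-4 : ∀ {v x} → inDeg G v ≡ 4 → 1 ≤ A x v → inDeg G x ≡ 1
  inNeighbour-of-4 {v} {x} in≡4 x→v =
    indicator-pos (inDeg G x ℕ.≟ 1) (≤-trans x→v (arc⇒one x))
    where
    one⇒arc : ∀ y → b2n ⌊ inDeg G y ℕ.≟ 1 ⌋ ≤ A y v
    one⇒arc y = b2n-≤ ⌊ inDeg G y ℕ.≟ 1 ⌋
      (λ is1 → low-in-degree-feeds-max (in≡1⇒<2 (indicator-pos (inDeg G y ℕ.≟ 1) is1)) in≡4)
    arc⇒one : ∀ y → A y v ≤ b2n ⌊ inDeg G y ℕ.≟ 1 ⌋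
    arc⇒one = Σ-tight one⇒arc (≤-reflexive (trans in≡4 (sym ones)))

  same-inNeighbours : ∀ {v₁ v₂} → inDeg G v₁ ≡ 4 → inDeg G v₂ ≡ 4 → ∀ w → A w v₁ ≤ A w v₂
  same-inNeighbours in₁≡4 in₂≡4 w = b2n-≤ _
    (λ w→v₁ → low-in-degree-feeds-max (in≡1⇒<2 (inNeighbour-of-4 in₁≡4 w→v₁)) in₂≡4)

theorem2 : (k : ℕ) → 2 ≤ k → (G : Digraph (Moore 2 k + 2)) → ¬ (IsGeodetic k G × MinOutDeg≥ 2 G × InSeq-1111-2-44 G)
theorem2 k _ G (geodetic , minOut , inSeq@(ones , fours , _))
  with count-two-witnesses (λ v → ⌊ inDeg G v ℕ.≟ 4 ⌋) (≤-reflexive (sym fours))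
... | v₁ , v₂ , v₁≢v₂ , is4₁ , is4₂ =
  no-dominated-max-vertex v₁≢v₂ (s≤s z≤n) in₁≡4 (same-inNeighbours in₁≡4 (toWitness is4₂))
  where
  regular : ∀ u → outDeg G u ≡ 2
  regular = Walks.out-regular G minOut (inSeq-degreeSum G inSeq)
  open Outliers {k} {2} {2} G geodetic regular using (no-dominated-max-vertex)
  open InDegreeSequence {k} G geodetic regular ones using (same-inNeighbours)
  in₁≡4 : inDeg G v₁ ≡ 4
  in₁≡4 = toWitness is4₁
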